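{- Let $n\ge3$, $k\in\{0,\dots,n-1\}$, let $B=\{p_1,\dots,p_{2n}\}$ be a symplectic base of $\Pi$, $\mathcal B$ the associated base subset of $\mathcal G_k$, and $\mathcal R\subset\mathcal B$. Suppose there exist $i,j\in\{1,\dots,2n\}$ with $j\ne i,\sigma(i)$ such that $p_j\in S_i(\mathcal R)$ and $p_{\sigma(i)}\in S_{\sigma(j)}(\mathcal R)$. Then $\mathcal R$ is inexact.
   Context: $V$ is a $2n$-dimensional vector space over a field $F$ with a non-degenerate symplectic form $\Omega$; $\Pi$ is the associated projective space (points are $1$-dimensional subspaces; $k$-dimensional projective subspaces are $(k+1)$-dimensional linear subspaces). $\langle x\rangle\perp\langle y\rangle$ iff $\Omega(x,y)=0$; totally isotropic subspaces have pairwise orthogonal points; $\mathcal G_k$ is the set of $k$-dimensional totally isotropic subspaces. A symplectic base is a base $\{p_1,\dots,p_{2n}\}$ of $\Pi$ such that for each $i$ there is a unique $\sigma(i)$ with $p_i\not\perp p_{\sigma(i)}$. The base subset $\mathcal B$ associated with $B$ is the set of elements of $\mathcal G_k$ spanned by points of $B$. For $\mathcal R\subset\mathcal B$, $S_i(\mathcal R)$ is the intersection of all elements of $\mathcal R$ containing $p_i$ if there is at least one such element, and $S_i(\mathcal R)=\emptyset$ otherwise. $\mathcal R$ is exact if exactly one base subset of $\mathcal G_k$ contains $\mathcal R$, and inexact otherwise. -}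

module Defs where

open import Level using (Level; _⊔_) renaming (suc to lsuc)
open import Data.Nat using (ℕ; zero; suc)
import Data.Nat
open import Data.Fin using (Fin; zero; suc)
open import Data.Product using (Σ; ∃; _×_; _,_)
open import Relation.Nullary using (¬_)
open import Relation.Binary.PropositionalEquality using (_≡_)
open import Algebra.Bundles using (CommutativeRing)

-- agda-stdlib has no Field bundle: a field is a commutative ring with 0 ≠ 1
-- in which every nonzero element has a multiplicative inverse.
record Field (c ℓ : Level) : Set (lsuc (c ⊔ ℓ)) where
  field
    commRing  : CommutativeRing c ℓ
  open CommutativeRing commRing public
  field
    0≉1       : ¬ (0# ≈ 1#)
    inverse   : ∀ x → ¬ (x ≈ 0#) → Σ Carrier λ y → (x * y) ≈ 1#

module _ {c ℓ : Level} (F : Field c ℓ) where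
  open Field F using (Carrier; _≈_; _+_; _*_; 0#; 1#)

  -- The 2n-dimensional vector space V, realised as coordinate vectors F^(2n)
  -- (every 2n-dimensional space is isomorphic to it; the form Ω is arbitrary).
  Vect : ℕ → Set c
  Vect m = Fin m → Carrier

  _≋_ : ∀ {m} → Vect m → Vect m → Set ℓ
  x ≋ y = ∀ t → x t ≈ y t

  IsZero : ∀ {m} → Vect m → Set ℓ
  IsZero x = ∀ t → x t ≈ 0#

  _⊕_ : ∀ {m} → Vect m → Vect m → Vect m
  (x ⊕ y) t = x t + y t

  _·_ : ∀ {m} → Carrier → Vect m → Vect m
  (a · x) t = a * x t

  ∑ : ∀ {r} → (Fin r → Carrier) → Carrier
  ∑ {zero}  f = 0#
  ∑ {suc r} f = f zero + ∑ (λ i → f (suc i))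

  LinComb : ∀ {m r} → (Fin r → Carrier) → (Fin r → Vect m) → Vect m
  LinComb cs v t = ∑ (λ i → cs i * v i t)

  Span : ∀ {m r} → (Fin r → Vect m) → Vect m → Set (c ⊔ ℓ)
  Span {r = r} v x = Σ (Fin r → Carrier) λ cs → x ≋ LinComb cs v

  LinIndep : ∀ {m r} → (Fin r → Vect m) → Set (c ⊔ ℓ)
  LinIndep {r = r} v = ∀ (cs : Fin r → Carrier) → IsZero (LinComb cs v) → ∀ i → cs i ≈ 0#

  Sub : ℕ → Set (lsuc (c ⊔ ℓ))
  Sub m = Vect m → Set (c ⊔ ℓ)

  _≐_ : ∀ {m} → Sub m → Sub m → Set (c ⊔ ℓ)
  S ≐ T = ∀ x → (S x → T x) × (T x → S x)

  Form : ℕ → Set c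
  Form m = Vect m → Vect m → Carrier

  record IsSymplecticForm {m : ℕ} (Ω : Form m) : Set (c ⊔ ℓ) where
    field
      cong      : ∀ {x x′ y y′} → x ≋ x′ → y ≋ y′ → Ω x y ≈ Ω x′ y′
      additiveˡ : ∀ x y z → Ω (x ⊕ y) z ≈ (Ω x z + Ω y z)
      homogˡ    : ∀ a x z → Ω (a · x) z ≈ (a * Ω x z)
      additiveʳ : ∀ x y z → Ω z (x ⊕ y) ≈ (Ω z x + Ω z y)
      homogʳ    : ∀ a x z → Ω z (a · x) ≈ (a * Ω z x)
      alternating : ∀ x → Ω x x ≈ 0#
      nondegenerate : ∀ x → (∀ y → Ω x y ≈ 0#) → IsZero x

  module _ (n : ℕ) (Ω : Form (2 Data.Nat.* n)) where
    private m = 2 Data.Nat.* n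

    -- p : Fin 2n → V lists representatives of the points p_1..p_2n.
    -- It is a symplectic base with companion map σ: the points form a base
    -- of Π (the vectors are linearly independent, hence a basis of V) and
    -- for every i, σ i is the unique index with p_i not ⊥ p_(σ i).
    record IsSymplecticBase (p : Fin m → Vect m) (σ : Fin m → Fin m) : Set (c ⊔ ℓ) where
      field
        independent : LinIndep p
        nonorth     : ∀ i → ¬ (Ω (p i) (p (σ i)) ≈ 0#)
        unique      : ∀ i j → ¬ (Ω (p i) (p j) ≈ 0#) → j ≡ σ i

    -- 𝒢_k : k-dimensional (projective) totally isotropic subspaces,
    -- i.e. (k+1)-dimensional linear subspaces on which Ω vanishes
    G : ℕ → Sub m → Set (c ⊔ ℓ)
    G k S = Σ (Fin (suc k) → Vect m) (λ v → LinIndep v × (S ≐ Span v))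
            × (∀ x y → S x → S y → Ω x y ≈ 0#)

    BaseSubset : ℕ → (Fin m → Vect m) → Sub m → Set (c ⊔ ℓ)
    BaseSubset k p S = G k S × Σ ℕ λ r → Σ (Fin r → Fin m) λ f → S ≐ Span (λ i → p (f i))

    SubFamily : Set (lsuc (c ⊔ ℓ))
    SubFamily = Sub m → Set (c ⊔ ℓ)

    _⊆_ : SubFamily → SubFamily → Set (lsuc (c ⊔ ℓ))
    𝓡 ⊆ 𝓢 = ∀ S → 𝓡 S → 𝓢 S

    -- "p_j ∈ S_i(𝓡)" for the (possibly empty) intersection S_i(𝓡) of all
    -- elements of 𝓡 containing p_i  (written here for vectors a = p_i, b = p_j)
    InS : SubFamily → Vect m → Vect m → Set (lsuc (c ⊔ ℓ))
    InS 𝓡 a b = (Σ (Sub m) λ S → 𝓡 S × S a) × (∀ S → 𝓡 S → S a → S b)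

    -- 𝓡 is exact: exactly one base subset of 𝒢_k contains 𝓡
    -- (base subsets are compared as sets of subspaces)
    Exact : ℕ → SubFamily → Set (lsuc (c ⊔ ℓ))
    Exact k 𝓡 =
      Σ (Fin m → Vect m) λ p → Σ (Fin m → Fin m) λ σ →
        IsSymplecticBase p σ × 𝓡 ⊆ BaseSubset k p ×
        (∀ (p′ : Fin m → Vect m) (σ′ : Fin m → Fin m) → IsSymplecticBase p′ σ′ →
           𝓡 ⊆ BaseSubset k p′ →
           ∀ S → (BaseSubset k p S → BaseSubset k p′ S) × (BaseSubset k p′ S → BaseSubset k p S))

    Inexact : ℕ → SubFamily → Set (lsuc (c ⊔ ℓ))
    Inexact k 𝓡 = ¬ Exact k 𝓡

-- Put v = p j and w = p (σ i); they are orthogonal, and T x = x + Ω(x, w) v + Ω(x, v) w is a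
-- linear symplectic automorphism fixing every p a with a ∉ {i, σ j}.  Each member of 𝓡 containing
-- p i contains p j, and each containing p (σ j) contains p (σ i); so T maps the spanning family of
-- every member of 𝓡 into that member, and 𝓡 lies in the base subsets of both p and T ∘ p.  These
-- differ: exchanging p j with p (σ j) in the spanning family of some S₀ ∈ 𝓡 through p i gives S₁ in
-- the base subset of p containing p i and p (σ j).  A member of the base subset of T ∘ p containing
-- p i either contains T (p j) = p j, which is not orthogonal to p (σ j), or is orthogonal to
-- T (p (σ j)), whereas Ω (p i) (T (p (σ j))) = Ω (p (σ j)) (p j) · Ω (p i) (p (σ i)) ≠ 0.

module Submission where

open import Level using (_⊔_)
open import Function using (_∘_)
open import Data.Nat as ℕ using (ℕ; zero; suc; _≤_; _<_)
open import Data.Fin using (Fin; zero; suc; _≟_)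
open import Data.Fin.Properties using (any?)
open import Data.Fin.Permutation.Components using (transpose)
open import Data.Vec.Functional using (_∷_)
open import Data.Product using (Σ; _×_; _,_; proj₁; proj₂; swap)
open import Data.Sum using (_⊎_; inj₁; inj₂)
open import Data.Empty using (⊥; ⊥-elim)
open import Relation.Nullary using (¬_; Dec; yes; no)
open import Relation.Nullary.Decidable using (dec-true; dec-false)
import Relation.Binary.PropositionalEquality as ≡
open ≡ using (_≡_; _≢_)
open import Defs hiding (_⊕_; _·_; _≋_; _≐_)

¬¬-∀-Fin : ∀ {a m} {P : Fin m → Set a} → (∀ i → ¬ ¬ P i) → ¬ ¬ (∀ i → P i)
¬¬-∀-Fin {m = zero}  _   ¬∀P = ¬∀P (λ ())
¬¬-∀-Fin {m = suc m} {P} ¬¬P ¬∀P =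
  ¬¬P zero (λ P₀ → ¬¬-∀-Fin {P = P ∘ suc} (¬¬P ∘ suc) (λ P₊ → ¬∀P (λ { zero → P₀ ; (suc i) → P₊ i })))

transpose-matchˡ : ∀ {m} (a b : Fin m) → transpose a b a ≡ b
transpose-matchˡ a b rewrite dec-true (a ≟ a) ≡.refl = ≡.refl

transpose-matchʳ : ∀ {m} (a b : Fin m) → transpose a b b ≡ a
transpose-matchʳ a b with b ≟ a
... | yes b≡a = b≡a
... | no  _ rewrite dec-true (b ≟ b) ≡.refl = ≡.refl

transpose-other : ∀ {m} {a b k : Fin m} → k ≢ a → k ≢ b → transpose a b k ≡ k
transpose-other {a = a} {b} {k} k≢a k≢b rewrite dec-false (k ≟ a) k≢a | dec-false (k ≟ b) k≢b = ≡.refl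

transpose-involutive : ∀ {m} (a b k : Fin m) → transpose a b (transpose a b k) ≡ k
transpose-involutive a b k = by-cases (k ≟ a) (k ≟ b)
  where
    by-cases : Dec (k ≡ a) → Dec (k ≡ b) → transpose a b (transpose a b k) ≡ k
    by-cases (yes ≡.refl) _ = ≡.trans (≡.cong (transpose a b) (transpose-matchˡ a b)) (transpose-matchʳ a b)
    by-cases (no _) (yes ≡.refl) = ≡.trans (≡.cong (transpose a b) (transpose-matchʳ a b)) (transpose-matchˡ a b)
    by-cases (no k≢a) (no k≢b) = ≡.trans (≡.cong (transpose a b) (transpose-other k≢a k≢b)) (transpose-other k≢a k≢b)

transpose-injective : ∀ {m} (a b : Fin m) {k l} → transpose a b k ≡ transpose a b l → k ≡ l
transpose-injective a b {k} {l} e =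
  ≡.trans (≡.sym (transpose-involutive a b k)) (≡.trans (≡.cong (transpose a b) e) (transpose-involutive a b l))

transpose-conj : ∀ {m} (σ : Fin m → Fin m) → (∀ a → σ (σ a) ≡ a) →
                 ∀ j a → transpose j (σ j) (σ a) ≡ σ (transpose j (σ j) a)
transpose-conj {m} σ σ-inv j a = by-cases (a ≟ j) (a ≟ σ j)
  where
    π : Fin m → Fin m
    π = transpose j (σ j)
    by-cases : Dec (a ≡ j) → Dec (a ≡ σ j) → π (σ a) ≡ σ (π a)
    by-cases (yes ≡.refl) _ =
      ≡.trans (transpose-matchʳ j (σ j)) (≡.trans (≡.sym (σ-inv j)) (≡.cong σ (≡.sym (transpose-matchˡ j (σ j)))))
    by-cases (no _) (yes ≡.refl) =
      ≡.trans (≡.cong π (σ-inv j)) (≡.trans (transpose-matchˡ j (σ j)) (≡.cong σ (≡.sym (transpose-matchʳ j (σ j)))))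
    by-cases (no a≢j) (no a≢σj) =
      ≡.trans (transpose-other (λ σa≡j → a≢σj (≡.trans (≡.sym (σ-inv a)) (≡.cong σ σa≡j)))
                               (λ σa≡σj → a≢j (≡.trans (≡.sym (σ-inv a)) (≡.trans (≡.cong σ σa≡σj) (σ-inv j)))))
              (≡.cong σ (≡.sym (transpose-other a≢j a≢σj)))

module FieldProperties {c ℓ} (F : Field c ℓ) where
  open Field F
  open import Relation.Binary.Reasoning.Setoid setoid

  *-nonzero : ∀ {a b} → ¬ a ≈ 0# → ¬ b ≈ 0# → ¬ a * b ≈ 0#
  *-nonzero {a} {b} a≉0 b≉0 ab≈0 with inverse a a≉0
  ... | a⁻¹ , a*a⁻¹≈1 = b≉0 (begin
    b              ≈⟨ *-identityˡ b ⟨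
    1# * b         ≈⟨ *-congʳ (trans (sym a*a⁻¹≈1) (*-comm a a⁻¹)) ⟩
    (a⁻¹ * a) * b  ≈⟨ *-assoc a⁻¹ a b ⟩
    a⁻¹ * (a * b)  ≈⟨ *-congˡ ab≈0 ⟩
    a⁻¹ * 0#       ≈⟨ zeroʳ a⁻¹ ⟩
    0#             ∎)

module Vectors {c ℓ} (F : Field c ℓ) where
  open Field F hiding (zero)
  open import Algebra.Properties.Semiring.Sum semiring
    using (sum; sum-cong-≋; ∑-distrib-+; *-distribˡ-sum; sum-replicate-zero)
  open import Data.Vec.Functional.Relation.Binary.Equality.Setoid setoid public
    using (_≋_; ≋-reflexive; ≋-sym; ≋-trans)
  open import Relation.Binary.Reasoning.Setoid setoid

  infixl 6 _+ᴹ_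
  infixr 7 _*ₗ_

  _+ᴹ_ : ∀ {m} → Vect F m → Vect F m → Vect F m
  _+ᴹ_ = Defs._⊕_ F

  _*ₗ_ : ∀ {m} → Carrier → Vect F m → Vect F m
  _*ₗ_ = Defs._·_ F

  0ᴹ : ∀ {m} → Vect F m
  0ᴹ _ = 0#

  _≐_ : ∀ {m} → Sub F m → Sub F m → Set (c ⊔ ℓ)
  _≐_ = Defs._≐_ F

  ≐-refl : ∀ {m} {S : Sub F m} → S ≐ S
  ≐-refl x = (λ s → s) , (λ s → s)

  ≐-sym : ∀ {m} {S T : Sub F m} → S ≐ T → T ≐ S
  ≐-sym S≐T x = swap (S≐T x)

  ≐-trans : ∀ {m} {S T U : Sub F m} → S ≐ T → T ≐ U → S ≐ U
  ≐-trans S≐T T≐U x = proj₁ (T≐U x) ∘ proj₁ (S≐T x) , proj₂ (S≐T x) ∘ proj₂ (T≐U x)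

  ∑≡sum : ∀ {r} (f : Fin r → Carrier) → ∑ F f ≡ sum f
  ∑≡sum {zero}  f = ≡.refl
  ∑≡sum {suc r} f = ≡.cong (f zero +_) (∑≡sum (f ∘ suc))

  module _ {m r : ℕ} (q : Fin r → Vect F m) where

    LinComb-zero : LinComb F (λ _ → 0#) q ≋ 0ᴹ
    LinComb-zero t = begin
      ∑ F (λ i → 0# * q i t)   ≡⟨ ∑≡sum (λ i → 0# * q i t) ⟩
      sum (λ i → 0# * q i t)   ≈⟨ sum-cong-≋ {r} (λ i → zeroˡ (q i t)) ⟩
      sum {r} (λ _ → 0#)       ≈⟨ sum-replicate-zero r ⟩
      0#                       ∎

    LinComb-+ : ∀ as bs → LinComb F (λ i → as i + bs i) q ≋ LinComb F as q +ᴹ LinComb F bs q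
    LinComb-+ as bs t = begin
      ∑ F (λ i → (as i + bs i) * q i t)        ≡⟨ ∑≡sum (λ i → (as i + bs i) * q i t) ⟩
      sum (λ i → (as i + bs i) * q i t)        ≈⟨ sum-cong-≋ {r} (λ i → distribʳ (q i t) (as i) (bs i)) ⟩
      sum (λ i → as i * q i t + bs i * q i t)  ≈⟨ ∑-distrib-+ (λ i → as i * q i t) (λ i → bs i * q i t) ⟩
      sum (λ i → as i * q i t) + sum (λ i → bs i * q i t)
        ≡⟨ ≡.cong₂ _+_ (∑≡sum (λ i → as i * q i t)) (∑≡sum (λ i → bs i * q i t)) ⟨
      LinComb F as q t + LinComb F bs q t      ∎

    LinComb-* : ∀ a as → LinComb F (λ i → a * as i) q ≋ a *ₗ LinComb F as q
    LinComb-* a as t = begin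
      ∑ F (λ i → (a * as i) * q i t)  ≡⟨ ∑≡sum (λ i → (a * as i) * q i t) ⟩
      sum (λ i → (a * as i) * q i t)  ≈⟨ sum-cong-≋ {r} (λ i → *-assoc a (as i) (q i t)) ⟩
      sum (λ i → a * (as i * q i t))  ≈⟨ *-distribˡ-sum a (λ i → as i * q i t) ⟨
      a * sum (λ i → as i * q i t)    ≡⟨ ≡.cong (a *_) (∑≡sum (λ i → as i * q i t)) ⟨
      a * LinComb F as q t            ∎

  module _ {m r : ℕ} {q : Fin r → Vect F m} where

    span-resp : ∀ {x y} → x ≋ y → Span F q y → Span F q x
    span-resp x≋y (cs , y≋) = cs , ≋-trans x≋y y≋

    span-0 : Span F q 0ᴹ
    span-0 = (λ _ → 0#) , ≋-sym (LinComb-zero q)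

    span-+ : ∀ {x y} → Span F q x → Span F q y → Span F q (x +ᴹ y)
    span-+ (as , x≋) (bs , y≋) =
      (λ i → as i + bs i) , ≋-trans (λ t → +-cong (x≋ t) (y≋ t)) (≋-sym (LinComb-+ q as bs))

    span-* : ∀ a {x} → Span F q x → Span F q (a *ₗ x)
    span-* a (as , x≋) = (λ i → a * as i) , ≋-trans (λ t → *-congˡ (x≋ t)) (≋-sym (LinComb-* q a as))

    span-LinComb : ∀ {s} {u : Fin s → Vect F m} cs → (∀ i → Span F q (u i)) → Span F q (LinComb F cs u)
    span-LinComb {zero}  cs u∈ = span-0
    span-LinComb {suc s} cs u∈ = span-+ (span-* (cs zero) (u∈ zero)) (span-LinComb (cs ∘ suc) (u∈ ∘ suc))

    span-mono : ∀ {s} {u : Fin s → Vect F m} → (∀ i → Span F q (u i)) → ∀ {x} → Span F u x → Span F q x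
    span-mono u∈ (cs , x≋) = span-resp x≋ (span-LinComb cs u∈)

  span-there : ∀ {m r} {q : Fin (suc r) → Vect F m} {x} → Span F (q ∘ suc) x → Span F q x
  span-there {q = q} (cs , x≋) = (0# ∷ cs) , λ t →
    trans (x≋ t) (sym (trans (+-congʳ (zeroˡ (q zero t))) (+-identityˡ _)))

  span-gen : ∀ {m r} (q : Fin r → Vect F m) i → Span F q (q i)
  span-gen {r = suc r} q zero    = (1# ∷ λ _ → 0#) , λ t → sym (begin
    1# * q zero t + LinComb F (λ _ → 0#) (q ∘ suc) t ≈⟨ +-cong (*-identityˡ _) (LinComb-zero (q ∘ suc) t) ⟩
    q zero t + 0#                                    ≈⟨ +-identityʳ _ ⟩
    q zero t                                         ∎)
  span-gen {r = suc r} q (suc i) = span-there {q = q} (span-gen (q ∘ suc) i)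

  span-≐ : ∀ {m r s} {a : Fin r → Vect F m} {b : Fin s → Vect F m} →
           (∀ i → Span F b (a i)) → (∀ i → Span F a (b i)) → Span F a ≐ Span F b
  span-≐ a∈ b∈ x = span-mono a∈ , span-mono b∈

  span-≐-pointwise : ∀ {m r} {a b : Fin r → Vect F m} → (∀ i → a i ≋ b i) → Span F a ≐ Span F b
  span-≐-pointwise {a = a} {b} a≋b =
    span-≐ (λ i → span-resp (a≋b i) (span-gen b i)) (λ i → span-resp (≋-sym (a≋b i)) (span-gen a i))

  record IsLinear {m} (M : Vect F m → Vect F m) : Set (c ⊔ ℓ) where
    field
      cong   : ∀ {x y} → x ≋ y → M x ≋ M y
      +-homo : ∀ x y → M (x +ᴹ y) ≋ M x +ᴹ M y
      *-homo : ∀ a x → M (a *ₗ x) ≋ a *ₗ M x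

  module _ {m} {M : Vect F m → Vect F m} (M-linear : IsLinear M) where
    open IsLinear M-linear

    linear-0 : M 0ᴹ ≋ 0ᴹ
    linear-0 t = begin
      M 0ᴹ t           ≈⟨ cong {0ᴹ} {0# *ₗ 0ᴹ} (λ _ → sym (zeroˡ 0#)) t ⟩
      M (0# *ₗ 0ᴹ) t   ≈⟨ *-homo 0# 0ᴹ t ⟩
      0# * M 0ᴹ t      ≈⟨ zeroˡ _ ⟩
      0#               ∎

    linear-LinComb : ∀ {r} cs (q : Fin r → Vect F m) → M (LinComb F cs q) ≋ LinComb F cs (M ∘ q)
    linear-LinComb {zero}  cs q = linear-0
    linear-LinComb {suc r} cs q t = begin
      M (cs zero *ₗ q zero +ᴹ LinComb F (cs ∘ suc) (q ∘ suc)) t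
        ≈⟨ +-homo _ _ t ⟩
      M (cs zero *ₗ q zero) t + M (LinComb F (cs ∘ suc) (q ∘ suc)) t
        ≈⟨ +-cong (*-homo _ _ t) (linear-LinComb (cs ∘ suc) (q ∘ suc) t) ⟩
      LinComb F cs (M ∘ q) t
        ∎

    span-image : ∀ {r} {q : Fin r → Vect F m} {x} → Span F q x → Span F (M ∘ q) (M x)
    span-image {q = q} (cs , x≋) = cs , ≋-trans (cong x≋) (linear-LinComb cs q)

    span-≐-image : ∀ {r s} {a : Fin r → Vect F m} {b : Fin s → Vect F m} →
                   Span F a ≐ Span F b → Span F (M ∘ a) ≐ Span F (M ∘ b)
    span-≐-image {a = a} {b} a≐b =
      span-≐ (λ i → span-image (proj₁ (a≐b (a i)) (span-gen a i)))
             (λ i → span-image (proj₂ (a≐b (b i)) (span-gen b i)))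

    span-≐-invariant : ∀ {N : Vect F m → Vect F m} → (∀ x → M (N x) ≋ x) → ∀ {r} {q : Fin r → Vect F m} →
                       (∀ i → Span F q (M (q i))) → (∀ i → Span F q (N (q i))) → Span F q ≐ Span F (M ∘ q)
    span-≐-invariant M∘N≋id {q = q} M-inv N-inv =
      span-≐ (λ i → span-resp (≋-sym (M∘N≋id (q i))) (span-image (N-inv i))) M-inv

  LinIndep-image : ∀ {m} {M N : Vect F m → Vect F m} → IsLinear M → IsLinear N → (∀ x → N (M x) ≋ x) →
                   ∀ {r} {q : Fin r → Vect F m} → LinIndep F q → LinIndep F (M ∘ q)
  LinIndep-image M-linear N-linear N∘M≋id {q = q} q-indep cs Mq≋0 = q-indep cs
    (≋-trans (≋-sym (N∘M≋id _))
      (≋-trans (IsLinear.cong N-linear (≋-trans (linear-LinComb M-linear cs q) Mq≋0)) (linear-0 N-linear)))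

module Symplectic {c ℓ} (F : Field c ℓ) {m : ℕ} (Ω : Form F m) (Ω-symplectic : IsSymplecticForm F Ω) where
  open Field F hiding (zero)
  open Vectors F
  open IsSymplecticForm Ω-symplectic renaming (cong to Ω-cong)
  open import Algebra.Properties.Ring ring
    using (-1*x≈-x; -‿distribʳ-*; -0#≈0#; +-inverseˡ-unique; -‿+-comm; xyx⁻¹≈y; ⁻¹-anti-homo‿-)
  open import Algebra.Solver.Ring.NaturalCoefficients.Default commutativeSemiring using (solve; _:+_; _:*_; _:=_)
  open import Relation.Binary.Reasoning.Setoid setoid

  private
    V : Set c
    V = Vect F m

  Ω-antisym : ∀ x y → Ω x y ≈ - Ω y x
  Ω-antisym x y = +-inverseˡ-unique (Ω x y) (Ω y x) (begin
    Ω x y + Ω y x                     ≈⟨ +-cong (+-identityˡ _) (+-identityʳ _) ⟨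
    (0# + Ω x y) + (Ω y x + 0#)       ≈⟨ +-cong (+-congʳ (alternating x)) (+-congˡ (alternating y)) ⟨
    (Ω x x + Ω x y) + (Ω y x + Ω y y) ≈⟨ +-cong (additiveʳ x y x) (additiveʳ x y y) ⟨
    Ω x (x +ᴹ y) + Ω y (x +ᴹ y)       ≈⟨ additiveˡ x y (x +ᴹ y) ⟨
    Ω (x +ᴹ y) (x +ᴹ y)               ≈⟨ alternating (x +ᴹ y) ⟩
    0#                                ∎)

  Ω-orth-sym : ∀ {x y} → Ω x y ≈ 0# → Ω y x ≈ 0#
  Ω-orth-sym {x} {y} x⊥y = trans (Ω-antisym y x) (trans (-‿cong x⊥y) -0#≈0#)

  Ω-zeroˡ : ∀ y → Ω 0ᴹ y ≈ 0#
  Ω-zeroˡ y = begin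
    Ω 0ᴹ y          ≈⟨ Ω-cong {0ᴹ} {0# *ₗ 0ᴹ} (λ _ → sym (zeroˡ 0#)) (λ _ → refl) ⟩
    Ω (0# *ₗ 0ᴹ) y  ≈⟨ homogˡ 0# 0ᴹ y ⟩
    0# * Ω 0ᴹ y     ≈⟨ zeroˡ _ ⟩
    0#              ∎

  LinComb-orthˡ : ∀ {r} {q : Fin r → V} {y} → (∀ i → Ω (q i) y ≈ 0#) → ∀ cs → Ω (LinComb F cs q) y ≈ 0#
  LinComb-orthˡ {zero}          {y = y} q⊥y cs = Ω-zeroˡ y
  LinComb-orthˡ {suc r} {q = q} {y = y} q⊥y cs = begin
    Ω (cs zero *ₗ q zero +ᴹ LinComb F (cs ∘ suc) (q ∘ suc)) y
      ≈⟨ additiveˡ _ _ y ⟩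
    Ω (cs zero *ₗ q zero) y + Ω (LinComb F (cs ∘ suc) (q ∘ suc)) y
      ≈⟨ +-cong (trans (homogˡ _ _ y) (trans (*-congˡ (q⊥y zero)) (zeroʳ _))) (LinComb-orthˡ (q⊥y ∘ suc) (cs ∘ suc)) ⟩
    0# + 0#
      ≈⟨ +-identityʳ 0# ⟩
    0# ∎

  span-orthˡ : ∀ {r} {q : Fin r → V} {x y} → (∀ i → Ω (q i) y ≈ 0#) → Span F q x → Ω x y ≈ 0#
  span-orthˡ q⊥y (cs , x≋) = trans (Ω-cong x≋ (λ _ → refl)) (LinComb-orthˡ q⊥y cs)

  span-isotropic : ∀ {r} {q : Fin r → V} → (∀ i j → Ω (q i) (q j) ≈ 0#) →
                   ∀ {x y} → Span F q x → Span F q y → Ω x y ≈ 0#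
  span-isotropic q-iso x∈ y∈ = span-orthˡ (λ i → Ω-orth-sym (span-orthˡ (λ j → q-iso j i) y∈)) x∈

  id-linear : IsLinear (λ (x : V) → x)
  id-linear = record { cong = λ x≋y → x≋y ; +-homo = λ _ _ _ → refl ; *-homo = λ _ _ _ → refl }

  +-linear : ∀ {M N : V → V} → IsLinear M → IsLinear N → IsLinear (λ x → M x +ᴹ N x)
  +-linear {M} {N} M-linear N-linear = record
    { cong   = λ x≋y t → +-cong (M.cong x≋y t) (N.cong x≋y t)
    ; +-homo = λ x y t → trans (+-cong (M.+-homo x y t) (N.+-homo x y t)) (interchange _ _ _ _)
    ; *-homo = λ a x t → trans (+-cong (M.*-homo a x t) (N.*-homo a x t)) (sym (distribˡ a _ _))
    }
    where
      module M = IsLinear M-linear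
      module N = IsLinear N-linear
      interchange : ∀ a b c d → (a + b) + (c + d) ≈ (a + c) + (b + d)
      interchange = solve 4 (λ a b c d → (a :+ b) :+ (c :+ d) := (a :+ c) :+ (b :+ d)) refl

  rankOne : Carrier → V → V → V → V
  rankOne c z d x = (c * Ω x z) *ₗ d

  rankOne-linear : ∀ c z d → IsLinear (rankOne c z d)
  rankOne-linear c z d = record
    { cong   = λ x≋y t → *-congʳ (*-congˡ (Ω-cong x≋y (λ _ → refl)))
    ; +-homo = λ x y t → trans (*-congʳ (trans (*-congˡ (additiveˡ x y z)) (distribˡ c _ _))) (distribʳ (d t) _ _)
    ; *-homo = λ a x t → trans (*-congʳ (*-congˡ (homogˡ a x z))) (assoc-comm a (Ω x z) (d t))
    }
    where
      assoc-comm : ∀ a A D → (c * (a * A)) * D ≈ a * ((c * A) * D)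
      assoc-comm = solve 4 (λ c a A D → (c :* (a :* A)) :* D := a :* ((c :* A) :* D)) refl c

  rankOne-orth : ∀ {c z d x} → Ω x z ≈ 0# → rankOne c z d x ≋ 0ᴹ
  rankOne-orth {c} {d = d} x⊥z t = trans (*-congʳ (trans (*-congˡ x⊥z) (zeroʳ c))) (zeroˡ (d t))

  span-rankOne : ∀ {r} {q : Fin r → V} {c z d x} → Ω x z ≈ 0# ⊎ Span F q d → Span F q (rankOne c z d x)
  span-rankOne (inj₁ x⊥z) = span-resp (rankOne-orth x⊥z) span-0
  span-rankOne (inj₂ d∈)  = span-* _ d∈

  shear : Carrier → V → V → V → V
  shear c z d x = x +ᴹ rankOne c z d x

  shear-linear : ∀ c z d → IsLinear (shear c z d)
  shear-linear c z d = +-linear id-linear (rankOne-linear c z d)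

  Ω-shearˡ : ∀ c z d x y → Ω (shear c z d x) y ≈ Ω x y + (c * Ω x z) * Ω d y
  Ω-shearˡ c z d x y = trans (additiveˡ x _ y) (+-congˡ (homogˡ _ d y))

  Ω-shearʳ : ∀ c z d x y → Ω y (shear c z d x) ≈ Ω y x + (c * Ω x z) * Ω y d
  Ω-shearʳ c z d x y = trans (additiveʳ x _ y) (+-congˡ (homogʳ _ d y))

  shear-fix : ∀ {c z d x} → Ω x z ≈ 0# → shear c z d x ≋ x
  shear-fix {c} {z} {d} x⊥z t = trans (+-congˡ (rankOne-orth {c} {z} {d} x⊥z t)) (+-identityʳ _)

  shear-inverse : ∀ c c′ z d → c + c′ + c′ * (c * Ω d z) ≈ 0# → ∀ x → shear c′ z d (shear c z d x) ≋ x
  shear-inverse c c′ z d vanish x t = begin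
    (x t + (c * A) * d t) + (c′ * Ω (shear c z d x) z) * d t ≈⟨ +-congˡ (*-congʳ (*-congˡ (Ω-shearˡ c z d x z))) ⟩
    (x t + (c * A) * d t) + (c′ * (A + (c * A) * E)) * d t   ≈⟨ collect (x t) c c′ A E (d t) ⟩
    x t + ((c + c′ + c′ * (c * E)) * A) * d t                ≈⟨ +-congˡ (trans (*-congʳ (trans (*-congʳ vanish) (zeroˡ A))) (zeroˡ _)) ⟩
    x t + 0#                                                 ≈⟨ +-identityʳ _ ⟩
    x t                                                      ∎
    where
      A E : Carrier
      A = Ω x z
      E = Ω d z
      collect : ∀ X c c′ A E D → (X + (c * A) * D) + (c′ * (A + (c * A) * E)) * D ≈ X + ((c + c′ + c′ * (c * E)) * A) * D
      collect = solve 6 (λ X c c′ A E D →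
        (X :+ (c :* A) :* D) :+ (c′ :* (A :+ (c :* A) :* E)) :* D := X :+ ((c :+ c′ :+ c′ :* (c :* E)) :* A) :* D) refl

  module IsotropicPair (v w : V) (v⊥w : Ω v w ≈ 0#) where

    w⊥v : Ω w v ≈ 0#
    w⊥v = Ω-orth-sym v⊥w

    τ : Carrier → V → V
    τ c x = shear c w v x +ᴹ rankOne c v w x

    τ-linear : ∀ c → IsLinear (τ c)
    τ-linear c = +-linear (shear-linear c w v) (rankOne-linear c v w)

    Ω-τˡ : ∀ c x y → Ω (τ c x) y ≈ (Ω x y + (c * Ω x w) * Ω v y) + (c * Ω x v) * Ω w y
    Ω-τˡ c x y = trans (additiveˡ _ _ y) (+-cong (Ω-shearˡ c w v x y) (homogˡ _ w y))

    Ω-τʳ : ∀ c x y → Ω y (τ c x) ≈ (Ω y x + (c * Ω x w) * Ω y v) + (c * Ω x v) * Ω y w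
    Ω-τʳ c x y = trans (additiveʳ _ _ y) (+-cong (Ω-shearʳ c w v x y) (homogʳ _ w y))

    Ω-τ-stable : ∀ c x {z} → Ω v z ≈ 0# → Ω w z ≈ 0# → Ω (τ c x) z ≈ Ω x z
    Ω-τ-stable c x v⊥z w⊥z = trans (Ω-τˡ c x _)
      (trans (+-cong (+-congˡ (trans (*-congˡ v⊥z) (zeroʳ _))) (trans (*-congˡ w⊥z) (zeroʳ _)))
             (trans (+-identityʳ _) (+-identityʳ _)))

    τ-fix : ∀ c {x} → Ω x w ≈ 0# → Ω x v ≈ 0# → τ c x ≋ x
    τ-fix c x⊥w x⊥v t =
      trans (+-cong (shear-fix {c} {w} {v} x⊥w t) (rankOne-orth {c} {v} {w} x⊥v t)) (+-identityʳ _)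

    τ-inverse : ∀ c c′ → c + c′ ≈ 0# → ∀ x → τ c′ (τ c x) ≋ x
    τ-inverse c c′ vanish x t = begin
      (τ c x t + (c′ * Ω (τ c x) w) * v t) + (c′ * Ω (τ c x) v) * w t
        ≈⟨ +-cong (+-congˡ (*-congʳ (*-congˡ (Ω-τ-stable c x v⊥w (alternating w)))))
                  (*-congʳ (*-congˡ (Ω-τ-stable c x (alternating v) w⊥v))) ⟩
      (((x t + (c * A) * v t) + (c * B) * w t) + (c′ * A) * v t) + (c′ * B) * w t
        ≈⟨ collect (x t) c c′ A B (v t) (w t) ⟩
      x t + (((c + c′) * A) * v t + ((c + c′) * B) * w t)
        ≈⟨ +-congˡ (+-cong (killed A (v t)) (killed B (w t))) ⟩
      x t + (0# + 0#)
        ≈⟨ trans (+-congˡ (+-identityʳ 0#)) (+-identityʳ _) ⟩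
      x t ∎
      where
        A B : Carrier
        A = Ω x w
        B = Ω x v
        killed : ∀ E D → ((c + c′) * E) * D ≈ 0#
        killed E D = trans (*-congʳ (trans (*-congʳ vanish) (zeroˡ E))) (zeroˡ D)
        collect : ∀ X c c′ A B V W →
                  (((X + (c * A) * V) + (c * B) * W) + (c′ * A) * V) + (c′ * B) * W ≈
                  X + (((c + c′) * A) * V + ((c + c′) * B) * W)
        collect = solve 7 (λ X c c′ A B V W →
          (((X :+ (c :* A) :* V) :+ (c :* B) :* W) :+ (c′ :* A) :* V) :+ (c′ :* B) :* W :=
          X :+ (((c :+ c′) :* A) :* V :+ ((c :+ c′) :* B) :* W)) refl

    τ-symplectic : ∀ c x y → Ω (τ c x) (τ c y) ≈ Ω x y
    τ-symplectic c x y = begin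
      Ω (τ c x) (τ c y)
        ≈⟨ Ω-τʳ c y (τ c x) ⟩
      (Ω (τ c x) y + (c * C) * Ω (τ c x) v) + (c * D) * Ω (τ c x) w
        ≈⟨ +-cong (+-cong (Ω-τˡ c x y) (*-congˡ (Ω-τ-stable c x (alternating v) w⊥v)))
                  (*-congˡ (Ω-τ-stable c x v⊥w (alternating w))) ⟩
      (((Ω x y + (c * A) * Ω v y) + (c * B) * Ω w y) + (c * C) * B) + (c * D) * A
        ≈⟨ regroup (Ω x y) ((c * A) * Ω v y) ((c * B) * Ω w y) ((c * C) * B) ((c * D) * A) ⟩
      Ω x y + (((c * A) * Ω v y + (c * D) * A) + ((c * B) * Ω w y + (c * C) * B))
        ≈⟨ +-congˡ (+-cong (cancel A v) (cancel B w)) ⟩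
      Ω x y + (0# + 0#)
        ≈⟨ trans (+-congˡ (+-identityʳ 0#)) (+-identityʳ _) ⟩
      Ω x y ∎
      where
        A B C D : Carrier
        A = Ω x w
        B = Ω x v
        C = Ω y w
        D = Ω y v
        cancel : ∀ a z → (c * a) * Ω z y + (c * Ω y z) * a ≈ 0#
        cancel a z = begin
          (c * a) * Ω z y + (c * Ω y z) * a     ≈⟨ +-cong (*-congˡ (Ω-antisym z y)) (comm-assoc c (Ω y z) a) ⟩
          (c * a) * - Ω y z + (c * a) * Ω y z   ≈⟨ +-congʳ (-‿distribʳ-* _ _) ⟨
          - ((c * a) * Ω y z) + (c * a) * Ω y z ≈⟨ -‿inverseˡ _ ⟩
          0#                                    ∎
          where
            comm-assoc : ∀ c b a → (c * b) * a ≈ (c * a) * b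
            comm-assoc = solve 3 (λ c b a → (c :* b) :* a := (c :* a) :* b) refl
        regroup : ∀ X P Q R S → (((X + P) + Q) + R) + S ≈ X + ((P + S) + (Q + R))
        regroup = solve 5 (λ X P Q R S → (((X :+ P) :+ Q) :+ R) :+ S := X :+ ((P :+ S) :+ (Q :+ R))) refl

    span-τ : ∀ c {r} {q : Fin r → V} {x} → Span F q x →
             Ω x w ≈ 0# ⊎ Span F q v → Ω x v ≈ 0# ⊎ Span F q w → Span F q (τ c x)
    span-τ c x∈ v-case w-case = span-+ (span-+ x∈ (span-rankOne v-case)) (span-rankOne w-case)

  module Exchange (u w : V) (ω⁻¹ : Carrier) (ω*ω⁻¹≈1 : Ω u w * ω⁻¹ ≈ 1#) where

    private
      ω : Carrier
      ω = Ω u w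

      ω⁻¹*ω≈1 : ω⁻¹ * ω ≈ 1#
      ω⁻¹*ω≈1 = trans (*-comm ω⁻¹ ω) ω*ω⁻¹≈1

      z d : V
      z = u +ᴹ w
      d = w +ᴹ (- 1#) *ₗ u

      Ω-u-z : Ω u z ≈ ω
      Ω-u-z = trans (additiveʳ u w u) (trans (+-congʳ (alternating u)) (+-identityˡ ω))

      Ω-w-z : Ω w z ≈ - ω
      Ω-w-z = trans (additiveʳ u w w) (trans (+-cong (Ω-antisym w u) (alternating w)) (+-identityʳ _))

      d≈w-u : ∀ t → d t ≈ w t + - u t
      d≈w-u t = +-congˡ (-1*x≈-x (u t))

    exchange : V → V
    exchange = shear ω⁻¹ z d

    exchange-linear : IsLinear exchange
    exchange-linear = shear-linear ω⁻¹ z d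

    exchange-fix : ∀ {x} → Ω x u ≈ 0# → Ω x w ≈ 0# → exchange x ≋ x
    exchange-fix {x} x⊥u x⊥w = shear-fix {ω⁻¹} {z} {d} (trans (additiveʳ u w x) (trans (+-cong x⊥u x⊥w) (+-identityʳ 0#)))

    exchange-u : exchange u ≋ w
    exchange-u t = begin
      u t + (ω⁻¹ * Ω u z) * d t  ≈⟨ +-congˡ (trans (*-congʳ (trans (*-congˡ Ω-u-z) ω⁻¹*ω≈1)) (*-identityˡ _)) ⟩
      u t + d t                  ≈⟨ +-congˡ (d≈w-u t) ⟩
      u t + (w t + - u t)        ≈⟨ +-assoc _ _ _ ⟨
      (u t + w t) + - u t        ≈⟨ xyx⁻¹≈y _ _ ⟩
      w t                        ∎

    exchange-w : exchange w ≋ u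
    exchange-w t = begin
      w t + (ω⁻¹ * Ω w z) * d t  ≈⟨ +-congˡ (*-congʳ (trans (*-congˡ Ω-w-z) (sym (-‿distribʳ-* ω⁻¹ ω)))) ⟩
      w t + - (ω⁻¹ * ω) * d t    ≈⟨ +-congˡ (trans (*-congʳ (-‿cong ω⁻¹*ω≈1)) (-1*x≈-x _)) ⟩
      w t + - d t                ≈⟨ +-congˡ (trans (-‿cong (d≈w-u t)) (⁻¹-anti-homo‿- _ _)) ⟩
      w t + (u t + - w t)        ≈⟨ +-assoc _ _ _ ⟨
      (w t + u t) + - w t        ≈⟨ xyx⁻¹≈y _ _ ⟩
      u t                        ∎

    exchange-involutive : ∀ x → exchange (exchange x) ≋ x
    exchange-involutive = shear-inverse ω⁻¹ ω⁻¹ z d (begin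
      ω⁻¹ + ω⁻¹ + ω⁻¹ * (ω⁻¹ * Ω d z)  ≈⟨ +-congˡ (*-congˡ (*-congˡ Ω-d-z)) ⟩
      ω⁻¹ + ω⁻¹ + ω⁻¹ * (ω⁻¹ * - (ω + ω))  ≈⟨ +-congˡ (*-congˡ (-‿distribʳ-* ω⁻¹ _)) ⟨
      ω⁻¹ + ω⁻¹ + ω⁻¹ * - (ω⁻¹ * (ω + ω))  ≈⟨ +-congˡ (*-congˡ (-‿cong (trans (distribˡ ω⁻¹ ω ω) (+-cong ω⁻¹*ω≈1 ω⁻¹*ω≈1)))) ⟩
      ω⁻¹ + ω⁻¹ + ω⁻¹ * - (1# + 1#)        ≈⟨ +-congˡ (-‿distribʳ-* ω⁻¹ _) ⟨
      ω⁻¹ + ω⁻¹ + - (ω⁻¹ * (1# + 1#))      ≈⟨ +-congˡ (-‿cong (trans (distribˡ ω⁻¹ 1# 1#) (+-cong (*-identityʳ ω⁻¹) (*-identityʳ ω⁻¹)))) ⟩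
      ω⁻¹ + ω⁻¹ + - (ω⁻¹ + ω⁻¹)            ≈⟨ -‿inverseʳ _ ⟩
      0#                                    ∎)
      where
        Ω-d-z : Ω d z ≈ - (ω + ω)
        Ω-d-z = begin
          Ω d z                       ≈⟨ additiveˡ w _ z ⟩
          Ω w z + Ω ((- 1#) *ₗ u) z    ≈⟨ +-congˡ (trans (homogˡ (- 1#) u z) (-1*x≈-x _)) ⟩
          Ω w z + - Ω u z             ≈⟨ +-cong Ω-w-z (-‿cong Ω-u-z) ⟩
          - ω + - ω                   ≈⟨ -‿+-comm ω ω ⟩
          - (ω + ω)                   ∎

module SymplecticBase {c ℓ} (F : Field c ℓ) (n : ℕ) (Ω : Form F (2 ℕ.* n)) (Ω-symplectic : IsSymplecticForm F Ω)
                      {p : Fin (2 ℕ.* n) → Vect F (2 ℕ.* n)} {σ : Fin (2 ℕ.* n) → Fin (2 ℕ.* n)}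
                      (base : IsSymplecticBase F n Ω p σ) where
  open Field F hiding (zero)
  open Vectors F
  open Symplectic F Ω Ω-symplectic
  open IsSymplecticBase base

  σ-involutive : ∀ a → σ (σ a) ≡ a
  σ-involutive a = ≡.sym (unique (σ a) a (λ Ω≈0 → nonorth a (Ω-orth-sym Ω≈0)))

  σ-injective : ∀ {a b} → σ a ≡ σ b → a ≡ b
  σ-injective {a} {b} e = ≡.trans (≡.sym (σ-involutive a)) (≡.trans (≡.cong σ e) (σ-involutive b))

  base-image : ∀ {M N} → IsLinear M → IsLinear N → (∀ x → N (M x) ≋ x) → (∀ x y → Ω (M x) (M y) ≈ Ω x y) →
               IsSymplecticBase F n Ω (M ∘ p) σ
  base-image M-linear N-linear N∘M≋id M-symplectic = record
    { independent = LinIndep-image M-linear N-linear N∘M≋id independent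
    ; nonorth     = λ a Ω≈0 → nonorth a (trans (sym (M-symplectic (p a) (p (σ a)))) Ω≈0)
    ; unique      = λ a b Ω≉0 → unique a b (λ Ω≈0 → Ω≉0 (trans (M-symplectic (p a) (p b)) Ω≈0))
    }

  module _ (orthogonal : ∀ a b → b ≢ σ a → Ω (p a) (p b) ≈ 0#) (j : Fin (2 ℕ.* n)) where

    transpose-orth : ∀ {a b} → Ω (p a) (p b) ≈ 0# →
                     Ω (p (transpose j (σ j) a)) (p (transpose j (σ j) b)) ≈ 0#
    transpose-orth {a} {b} pa⊥pb = orthogonal _ _ λ πb≡σπa →
      nonorth a (≡.subst (λ x → Ω (p a) (p x) ≈ 0#)
                         (transpose-injective j (σ j) (≡.trans πb≡σπa (≡.sym (transpose-conj σ σ-involutive j a))))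
                         pa⊥pb)

-- IsSymplecticBase only says that σ a is the unique index whose point is not orthogonal to p a;
-- this gives orthogonality of the other pairs up to double negation, enough for a negative goal.
base-orthogonal : ∀ {c ℓ} (F : Field c ℓ) (n : ℕ) (Ω : Form F (2 ℕ.* n)) {p σ} → IsSymplecticBase F n Ω p σ →
                  ¬ ¬ (∀ a b → b ≢ σ a → Field._≈_ F (Ω (p a) (p b)) (Field.0# F))
base-orthogonal F n Ω {p} {σ} base = ¬¬-∀-Fin λ a → ¬¬-∀-Fin λ b → by-cases a b (b ≟ σ a)
  where
    open Field F using (_≈_; 0#)
    open IsSymplecticBase base
    by-cases : ∀ a b → Dec (b ≡ σ a) → ¬ ¬ (b ≢ σ a → Ω (p a) (p b) ≈ 0#)
    by-cases a b (yes b≡σa) ¬orth = ¬orth (λ b≢σa → ⊥-elim (b≢σa b≡σa))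
    by-cases a b (no b≢σa)  ¬orth = b≢σa (unique a b (λ Ω≈0 → ¬orth (λ _ → Ω≈0)))

module _ {c ℓ} (F : Field c ℓ) (n : ℕ) (Ω : Form F (2 ℕ.* n)) (k : ℕ) (𝓡 : SubFamily F n Ω) where

  exact-unique : Exact F n Ω k 𝓡 →
                 ∀ {p σ p′ σ′} → IsSymplecticBase F n Ω p σ → _⊆_ F n Ω 𝓡 (BaseSubset F n Ω k p) →
                 IsSymplecticBase F n Ω p′ σ′ → _⊆_ F n Ω 𝓡 (BaseSubset F n Ω k p′) →
                 ∀ {S} → BaseSubset F n Ω k p S → BaseSubset F n Ω k p′ S
  exact-unique (_ , _ , _ , _ , unique) {p} {σ} {p′} {σ′} base 𝓡⊆𝓑 base′ 𝓡⊆𝓑′ {S} S∈𝓑 =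
    proj₁ (unique p′ σ′ base′ 𝓡⊆𝓑′ S) (proj₂ (unique p σ base 𝓡⊆𝓑 S) S∈𝓑)

module Inexactness {c ℓ} (F : Field c ℓ) (n : ℕ) (Ω : Form F (2 ℕ.* n)) (Ω-symplectic : IsSymplecticForm F Ω)
  {p : Fin (2 ℕ.* n) → Vect F (2 ℕ.* n)} {σ : Fin (2 ℕ.* n) → Fin (2 ℕ.* n)} (base : IsSymplecticBase F n Ω p σ)
  (orthogonal : ∀ a b → b ≢ σ a → Field._≈_ F (Ω (p a) (p b)) (Field.0# F))
  (k : ℕ) (𝓡 : SubFamily F n Ω) (𝓡⊆𝓑 : _⊆_ F n Ω 𝓡 (BaseSubset F n Ω k p))
  {i j : Fin (2 ℕ.* n)} (j≢i : j ≢ i) (j≢σi : j ≢ σ i)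
  (pi↝pj : InS F n Ω 𝓡 (p i) (p j)) (pσj↝pσi : InS F n Ω 𝓡 (p (σ j)) (p (σ i))) where

  open Field F hiding (zero)
  open Vectors F
  open Symplectic F Ω Ω-symplectic
  open IsSymplecticBase base
  open SymplecticBase F n Ω Ω-symplectic base
  open FieldProperties F

  private
    V : Set c
    V = Vect F (2 ℕ.* n)

  σi≢σj : σ i ≢ σ j
  σi≢σj σi≡σj = j≢i (≡.sym (σ-injective σi≡σj))

  open IsotropicPair (p j) (p (σ i)) (orthogonal j (σ i) σi≢σj)

  T : V → V
  T = τ 1#

  T-base : IsSymplecticBase F n Ω (T ∘ p) σ
  T-base = base-image (τ-linear 1#) (τ-linear (- 1#)) (τ-inverse 1# (- 1#) (-‿inverseʳ 1#)) (τ-symplectic 1#)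

  𝓡⊆T-𝓑 : _⊆_ F n Ω 𝓡 (BaseSubset F n Ω k (T ∘ p))
  𝓡⊆T-𝓑 S S∈𝓡 with 𝓡⊆𝓑 S S∈𝓡
  ... | S∈𝓖 , r , f , S≐f = S∈𝓖 , r , f ,
    ≐-trans S≐f (span-≐-invariant (τ-linear 1#) (τ-inverse (- 1#) 1# (-‿inverseˡ 1#)) (τ-stable 1#) (τ-stable (- 1#)))
    where
      through-S : ∀ {x y} → (S x → S y) → Span F (p ∘ f) x → Span F (p ∘ f) y
      through-S S-closed x∈ = proj₁ (S≐f _) (S-closed (proj₂ (S≐f _) x∈))

      v-case : ∀ a → Span F (p ∘ f) (p a) → Ω (p a) (p (σ i)) ≈ 0# ⊎ Span F (p ∘ f) (p j)
      v-case a pa∈ with a ≟ i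
      ... | yes ≡.refl = inj₂ (through-S (proj₂ pi↝pj S S∈𝓡) pa∈)
      ... | no a≢i     = inj₁ (orthogonal a (σ i) (λ σi≡σa → a≢i (≡.sym (σ-injective σi≡σa))))

      w-case : ∀ a → Span F (p ∘ f) (p a) → Ω (p a) (p j) ≈ 0# ⊎ Span F (p ∘ f) (p (σ i))
      w-case a pa∈ with a ≟ σ j
      ... | yes ≡.refl = inj₂ (through-S (proj₂ pσj↝pσi S S∈𝓡) pa∈)
      ... | no a≢σj    = inj₁ (orthogonal a j (λ j≡σa → a≢σj (≡.trans (≡.sym (σ-involutive a)) (≡.cong σ (≡.sym j≡σa)))))

      τ-stable : ∀ c t → Span F (p ∘ f) (τ c (p (f t)))
      τ-stable c t = span-τ c pft∈ (v-case (f t) pft∈) (w-case (f t) pft∈)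
        where
          pft∈ : Span F (p ∘ f) (p (f t))
          pft∈ = span-gen (p ∘ f) t

  open Exchange (p j) (p (σ j)) (proj₁ (inverse _ (nonorth j))) (proj₂ (inverse _ (nonorth j)))

  π : Fin (2 ℕ.* n) → Fin (2 ℕ.* n)
  π = transpose j (σ j)

  exchange-p : ∀ a → exchange (p a) ≋ p (π a)
  exchange-p a = by-cases (a ≟ j) (a ≟ σ j)
    where
      by-cases : Dec (a ≡ j) → Dec (a ≡ σ j) → exchange (p a) ≋ p (π a)
      by-cases (yes ≡.refl) _ = ≋-trans exchange-u (≋-reflexive (≡.cong p (≡.sym (transpose-matchˡ j (σ j)))))
      by-cases (no _) (yes ≡.refl) = ≋-trans exchange-w (≋-reflexive (≡.cong p (≡.sym (transpose-matchʳ j (σ j)))))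
      by-cases (no a≢j) (no a≢σj) = ≋-trans
        (exchange-fix (orthogonal a j (λ j≡σa → a≢σj (≡.trans (≡.sym (σ-involutive a)) (≡.cong σ (≡.sym j≡σa)))))
                      (orthogonal a (σ j) (λ σj≡σa → a≢j (≡.sym (σ-injective σj≡σa)))))
        (≋-reflexive (≡.cong p (≡.sym (transpose-other a≢j a≢σj))))

  module Distinguished {S₀ : Sub F (2 ℕ.* n)} (S₀∈𝓡 : 𝓡 S₀) (pi∈S₀ : S₀ (p i))
                       {v₀ : Fin (suc k) → V} (v₀-indep : LinIndep F v₀) (S₀≐v₀ : S₀ ≐ Span F v₀)
                       (S₀-isotropic : ∀ x y → S₀ x → S₀ y → Ω x y ≈ 0#)
                       {r : ℕ} (f : Fin r → Fin (2 ℕ.* n)) (S₀≐f : S₀ ≐ Span F (p ∘ f)) where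

    S₁ : Sub F (2 ℕ.* n)
    S₁ = Span F (p ∘ π ∘ f)

    S₁≐exchange-f : S₁ ≐ Span F (exchange ∘ p ∘ f)
    S₁≐exchange-f = span-≐-pointwise (λ t → ≋-sym (exchange-p (f t)))

    exchange-S₀ : ∀ {x} → S₀ x → S₁ (exchange x)
    exchange-S₀ x∈ = proj₂ (S₁≐exchange-f _) (span-image exchange-linear (proj₁ (S₀≐f _) x∈))

    pi∈S₁ : S₁ (p i)
    pi∈S₁ = span-resp (≋-sym (exchange-fix (orthogonal i j j≢σi) (orthogonal i (σ j) (σi≢σj ∘ ≡.sym))))
                      (exchange-S₀ pi∈S₀)

    pσj∈S₁ : S₁ (p (σ j))
    pσj∈S₁ = span-resp (≋-sym exchange-u) (exchange-S₀ (proj₂ pi↝pj S₀ S₀∈𝓡 pi∈S₀))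

    S₁-isotropic : ∀ x y → S₁ x → S₁ y → Ω x y ≈ 0#
    S₁-isotropic x y = span-isotropic λ s t → transpose-orth orthogonal j (S₀-isotropic _ _ (generator s) (generator t))
      where
        generator : ∀ s → S₀ (p (f s))
        generator s = proj₂ (S₀≐f _) (span-gen (p ∘ f) s)

    S₁∈𝓑 : BaseSubset F n Ω k p S₁
    S₁∈𝓑 = ((exchange ∘ v₀ , LinIndep-image exchange-linear exchange-linear exchange-involutive {q = v₀} v₀-indep ,
             ≐-trans S₁≐exchange-f (span-≐-image exchange-linear {a = p ∘ f} {b = v₀} (≐-trans (≐-sym S₀≐f) S₀≐v₀))) ,
            S₁-isotropic) ,
           r , π ∘ f , ≐-refl

    Ω-pi-Tpσj : Ω (p i) (T (p (σ j))) ≈ Ω (p (σ j)) (p j) * Ω (p i) (p (σ i))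
    Ω-pi-Tpσj = begin
      Ω (p i) (T (p (σ j)))
        ≈⟨ Ω-τʳ 1# (p (σ j)) (p i) ⟩
      (Ω (p i) (p (σ j)) + (1# * Ω (p (σ j)) (p (σ i))) * Ω (p i) (p j)) + (1# * Ω (p (σ j)) (p j)) * Ω (p i) (p (σ i))
        ≈⟨ +-cong (+-cong (orthogonal i (σ j) (σi≢σj ∘ ≡.sym))
                          (*-congʳ (trans (*-congˡ (orthogonal (σ j) (σ i) σσj≢σi)) (zeroʳ 1#))))
                  (*-congʳ (*-identityˡ _)) ⟩
      (0# + 0# * Ω (p i) (p j)) + Ω (p (σ j)) (p j) * Ω (p i) (p (σ i))
        ≈⟨ trans (+-congʳ (trans (+-congˡ (zeroˡ _)) (+-identityʳ 0#))) (+-identityˡ _) ⟩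
      Ω (p (σ j)) (p j) * Ω (p i) (p (σ i)) ∎
      where
        open import Relation.Binary.Reasoning.Setoid setoid
        σσj≢σi : σ i ≢ σ (σ j)
        σσj≢σi σi≡σσj = j≢σi (≡.trans (≡.sym (σ-involutive j)) (≡.sym σi≡σσj))

    pi-Tpσj-nonorth : ¬ Ω (p i) (T (p (σ j))) ≈ 0#
    pi-Tpσj-nonorth Ω≈0 = *-nonzero pσj-pj-nonorth (nonorth i) (trans (sym Ω-pi-Tpσj) Ω≈0)
      where
        pσj-pj-nonorth : ¬ Ω (p (σ j)) (p j) ≈ 0#
        pσj-pj-nonorth = ≡.subst (λ a → ¬ Ω (p (σ j)) (p a) ≈ 0#) (σ-involutive j) (nonorth (σ j))

    S₁∉T-𝓑 : ¬ BaseSubset F n Ω k (T ∘ p) S₁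
    S₁∉T-𝓑 (_ , _ , h , S₁≐h) with any? (λ t → h t ≟ j)
    ... | yes (t , ht≡j) = nonorth j (S₁-isotropic _ _ pj∈S₁ pσj∈S₁)
      where
        pj∈S₁ : S₁ (p j)
        pj∈S₁ = proj₂ (S₁≐h _) (span-resp (≋-sym (τ-fix 1# (orthogonal j (σ i) σi≢σj) (IsSymplecticForm.alternating Ω-symplectic (p j))))
                                          (≡.subst (λ a → Span F (T ∘ p ∘ h) (T (p a))) ht≡j (span-gen (T ∘ p ∘ h) t)))
    ... | no j∉h = pi-Tpσj-nonorth (span-orthˡ Th⊥Tpσj (proj₁ (S₁≐h _) pi∈S₁))
      where
        Th⊥Tpσj : ∀ t → Ω (T (p (h t))) (T (p (σ j))) ≈ 0#
        Th⊥Tpσj t = trans (τ-symplectic 1# _ _)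
                          (orthogonal (h t) (σ j) (λ σj≡σht → j∉h (t , ≡.sym (σ-injective σj≡σht))))

  inexact : Inexact F n Ω k 𝓡
  inexact exact = distinguish (proj₁ pi↝pj)
    where
      distinguish : Σ (Sub F (2 ℕ.* n)) (λ S → 𝓡 S × S (p i)) → ⊥
      distinguish (S₀ , S₀∈𝓡 , pi∈S₀) with 𝓡⊆𝓑 S₀ S₀∈𝓡
      ... | ((v₀ , v₀-indep , S₀≐v₀) , S₀-isotropic) , _ , f , S₀≐f =
        S₁∉T-𝓑 (exact-unique F n Ω k 𝓡 exact base 𝓡⊆𝓑 T-base 𝓡⊆T-𝓑 S₁∈𝓑)
        where open Distinguished S₀∈𝓡 pi∈S₀ {v₀} v₀-indep S₀≐v₀ S₀-isotropic f S₀≐f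

open import Data.Nat using (_*_)

lemma1 : ∀ {c ℓ} (F : Field c ℓ) (n : ℕ) → 3 ≤ n → (k : ℕ) → k < n →
         (Ω : Form F (2 * n)) → IsSymplecticForm F Ω →
         (p : Fin (2 * n) → Vect F (2 * n)) (σ : Fin (2 * n) → Fin (2 * n)) →
         IsSymplecticBase F n Ω p σ →
         (𝓡 : SubFamily F n Ω) → _⊆_ F n Ω 𝓡 (BaseSubset F n Ω k p) →
         (i j : Fin (2 * n)) → j ≢ i → j ≢ σ i →
         InS F n Ω 𝓡 (p i) (p j) → InS F n Ω 𝓡 (p (σ j)) (p (σ i)) →
         Inexact F n Ω k 𝓡
lemma1 F n _ k _ Ω Ω-symplectic p σ base 𝓡 𝓡⊆𝓑 i j j≢i j≢σi pi↝pj pσj↝pσi exact =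
  base-orthogonal F n Ω base λ orthogonal →
    Inexactness.inexact F n Ω Ω-symplectic base orthogonal k 𝓡 𝓡⊆𝓑 j≢i j≢σi pi↝pj pσj↝pσi exact
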